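{- If $i \ge 1$ is an integer with $C(i) = 1$, then $\sigma_\infty(8i-2) = \sigma_\infty(8i-1)$.
   Context: $T:\mathbb{Z}^+\to\mathbb{Z}^+$ is defined by $T(x) = x/2$ if $x$ is even and $T(x) = (3x+1)/2$ if $x$ is odd; $T^k$ denotes the $k$-fold iterate, $T^0$ the identity. For $x \in \mathbb{Z}^+$, $\sigma_\infty(x)$ is the least $k \ge 0$ with $T^k(x) = 1$, and $\sigma_\infty(x) = \infty$ if no such $k$ exists. The function $C:\mathbb{Z}^+\to\{0,1\}$ is defined recursively by $C(1) = 0$, $C(n) = 1 - C(n-2)$ if $n > 1$ is odd, and $C(n) = 1 - C(n/2)$ if $n$ is even. -}

module Defs where

open import Data.Nat using (ℕ; zero; suc; _+_; _*_; _∸_; _<_)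
open import Data.Nat.Base using (_/_; _%_)
open import Data.Bool using (Bool; true; false; not)
open import Data.Product using (_×_)
open import Relation.Binary.PropositionalEquality using (_≡_)
open import Relation.Nullary using (¬_)
open import Function.Bundles using (_⇔_)

T : ℕ → ℕ
T x with x % 2
... | zero = x / 2
... | _    = (3 * x + 1) / 2

T^ : ℕ → ℕ → ℕ
T^ zero    x = x
T^ (suc k) x = T^ k (T x)

-- σ∞(x) = k  (finite stopping time equals k): k is the least with T^k(x) = 1
StopsAt : ℕ → ℕ → Set
StopsAt x k = (T^ k x ≡ 1) × (∀ j → j < k → ¬ (T^ j x ≡ 1))

-- σ∞(x) = σ∞(y) as values in ℕ ∪ {∞}: they have the same finite values
-- (and hence are both ∞ simultaneously).
SameStoppingTime : ℕ → ℕ → Set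
SameStoppingTime x y = ∀ k → StopsAt x k ⇔ StopsAt y k

-- C via fuel: Cf f n computes C(n) provided f ≥ n.
-- C(1) = 0, C(n) = 1 - C(n-2) for odd n > 1, C(n) = 1 - C(n/2) for even n.
Cf : ℕ → ℕ → ℕ
Cf zero    n = 0
Cf (suc f) zero = 0              -- n = 0 is outside the domain; value irrelevant
Cf (suc f) (suc zero) = 0
Cf (suc f) n with n % 2
... | zero = 1 ∸ Cf f (n / 2)
... | _    = 1 ∸ Cf f (n ∸ 2)

C : ℕ → ℕ
C n = Cf n n

-- Write i = 2^a w with w odd. The odd step 2p - 1 ↦ 3p - 1 applies a + 2 times
-- to T(8i - 2) = 2^(a+2) w - 1 and a + 3 times to 8i - 1 = 2^(a+3) w - 1,
-- giving 3^(a+2) w - 1 and 3^(a+3) w - 1. The function C records the residue of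
-- the odd part: C(2^a w) = 1 exactly when 3^a w ≡ 3 (mod 4). In that case, with
-- 3^(a+2) w = 3 + 4t, two more steps bring both orbits to 2 + 3t ≥ 3 at the
-- same time a + 5, and orbits that meet above 2 share their stopping time,
-- since {1, 2} is the only cycle through 1.
module Submission where

open import Defs
open import Data.Nat
open import Data.Nat.Properties
open import Data.Nat.DivMod
open import Data.Nat.Induction using (<-rec)
open import Data.Nat.Solver using (module +-*-Solver)
open import Data.Product using (_×_; _,_; proj₁; proj₂; ∃-syntax; ∃₂)
open import Data.Sum using (_⊎_; inj₁; inj₂)
open import Function using (mk⇔)
open import Relation.Nullary using (contradiction)
open import Relation.Binary.PropositionalEquality
open ≡-Reasoning
open +-*-Solver

m^[b+a]*w≡m^b*[m^a*w] : ∀ m b a w → m ^ (b + a) * w ≡ m ^ b * (m ^ a * w)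
m^[b+a]*w≡m^b*[m^a*w] m b a w = trans (cong (_* w) (^-distribˡ-+-* m b a)) (*-assoc (m ^ b) (m ^ a) w)

T-even : ∀ x → x % 2 ≡ 0 → T x ≡ x / 2
T-even x x%2≡0 with x % 2
... | zero = refl

T-odd : ∀ x → x % 2 ≡ 1 → T x ≡ (3 * x + 1) / 2
T-odd x x%2≡1 with x % 2
... | suc _ = refl

T[k*2]≡k : ∀ k → T (k * 2) ≡ k
T[k*2]≡k k = trans (T-even (k * 2) (m*n%n≡0 k 2)) (m*n/n≡m k 2)

T[1+k*2]≡2+3k : ∀ k → T (1 + k * 2) ≡ 2 + 3 * k
T[1+k*2]≡2+3k k = begin
  T (1 + k * 2)             ≡⟨ T-odd (1 + k * 2) ([m+kn]%n≡m%n 1 k 2) ⟩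
  (3 * (1 + k * 2) + 1) / 2 ≡⟨ cong (_/ 2) (solve 1 (λ k → con 3 :* (con 1 :+ k :* con 2) :+ con 1
                                                     := (con 2 :+ con 3 :* k) :* con 2) refl k) ⟩
  (2 + 3 * k) * 2 / 2       ≡⟨ m*n/n≡m (2 + 3 * k) 2 ⟩
  2 + 3 * k                 ∎

T[2p∸1]≡3p∸1 : ∀ {p} → 1 ≤ p → T (2 * p ∸ 1) ≡ 3 * p ∸ 1
T[2p∸1]≡3p∸1 {suc k} _ = begin
  T (2 * suc k ∸ 1) ≡⟨ cong (λ n → T (n ∸ 1)) (*-comm 2 (suc k)) ⟩
  T (1 + k * 2)     ≡⟨ T[1+k*2]≡2+3k k ⟩
  2 + 3 * k         ≡⟨ cong (_∸ 1) (solve 1 (λ k → con 3 :+ con 3 :* k := con 3 :* (con 1 :+ k)) refl k) ⟩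
  3 * suc k ∸ 1     ∎

T^-+ : ∀ a b x → T^ (a + b) x ≡ T^ b (T^ a x)
T^-+ zero    b x = refl
T^-+ (suc a) b x = T^-+ a b (T x)

T^-split : ∀ {n j} x → n ≤ j → T^ j x ≡ T^ (j ∸ n) (T^ n x)
T^-split {n} {j} x n≤j = trans (cong (λ k → T^ k x) (sym (m+[n∸m]≡n n≤j))) (T^-+ n (j ∸ n) x)

T^-cycle-1-2 : ∀ d → T^ d 1 ≤ 2 × T^ d 2 ≤ 2
T^-cycle-1-2 zero    = s≤s z≤n , ≤-refl
T^-cycle-1-2 (suc d) with T^-cycle-1-2 d
... | from1 , from2 = from2 , from1

hits-1-transfer : ∀ n {v x y} → T^ n x ≡ v → T^ n y ≡ v → 3 ≤ v →
                  ∀ j → T^ j x ≡ 1 → T^ j y ≡ 1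
hits-1-transfer n {v} {x} {y} xn≡v yn≡v 3≤v j xj≡1 with ≤-total j n
... | inj₁ j≤n = contradiction v≤2 (<⇒≱ 3≤v)
  where
  v≤2 : v ≤ 2
  v≤2 = subst (_≤ 2) (begin
    T^ (n ∸ j) 1         ≡⟨ cong (T^ (n ∸ j)) xj≡1 ⟨
    T^ (n ∸ j) (T^ j x)  ≡⟨ T^-split x j≤n ⟨
    T^ n x               ≡⟨ xn≡v ⟩
    v                    ∎) (proj₁ (T^-cycle-1-2 (n ∸ j)))
... | inj₂ n≤j = begin
  T^ j y               ≡⟨ T^-split y n≤j ⟩
  T^ (j ∸ n) (T^ n y)  ≡⟨ cong (T^ (j ∸ n)) (trans yn≡v (sym xn≡v)) ⟩
  T^ (j ∸ n) (T^ n x)  ≡⟨ T^-split x n≤j ⟨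
  T^ j x               ≡⟨ xj≡1 ⟩
  1                    ∎

StopsAt-transfer : ∀ n {v x y} → T^ n x ≡ v → T^ n y ≡ v → 3 ≤ v →
                   ∀ {k} → StopsAt x k → StopsAt y k
StopsAt-transfer n xn≡v yn≡v 3≤v {k} (xk≡1 , x-earlier≢1) =
  hits-1-transfer n xn≡v yn≡v 3≤v k xk≡1 ,
  λ j j<k yj≡1 → x-earlier≢1 j j<k (hits-1-transfer n yn≡v xn≡v 3≤v j yj≡1)

meet⇒SameStoppingTime : ∀ n {v x y} → T^ n x ≡ v → T^ n y ≡ v → 3 ≤ v →
                        SameStoppingTime x y
meet⇒SameStoppingTime n xn≡v yn≡v 3≤v k =
  mk⇔ (StopsAt-transfer n xn≡v yn≡v 3≤v) (StopsAt-transfer n yn≡v xn≡v 3≤v)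

T^[2^b*w∸1]≡3^b*w∸1 : ∀ b {w} → 1 ≤ w → T^ b (2 ^ b * w ∸ 1) ≡ 3 ^ b * w ∸ 1
T^[2^b*w∸1]≡3^b*w∸1 zero    _   = refl
T^[2^b*w∸1]≡3^b*w∸1 (suc b) {w} 1≤w = begin
  T^ b (T (2 * 2 ^ b * w ∸ 1))   ≡⟨ cong (λ n → T^ b (T (n ∸ 1))) (*-assoc 2 (2 ^ b) w) ⟩
  T^ b (T (2 * (2 ^ b * w) ∸ 1)) ≡⟨ cong (T^ b) (T[2p∸1]≡3p∸1 (*-mono-≤ (m^n>0 2 b) 1≤w)) ⟩
  T^ b (3 * (2 ^ b * w) ∸ 1)     ≡⟨ cong (λ n → T^ b (n ∸ 1)) (swap (2 ^ b)) ⟩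
  T^ b (2 ^ b * (3 * w) ∸ 1)     ≡⟨ T^[2^b*w∸1]≡3^b*w∸1 b (*-mono-≤ {1} {3} (s≤s z≤n) 1≤w) ⟩
  3 ^ b * (3 * w) ∸ 1            ≡⟨ cong (_∸ 1) (trans (sym (swap (3 ^ b))) (sym (*-assoc 3 (3 ^ b) w))) ⟩
  3 * 3 ^ b * w ∸ 1              ∎
  where
  swap : ∀ p → 3 * (p * w) ≡ p * (3 * w)
  swap p = solve 2 (λ p w → con 3 :* (p :* w) := p :* (con 3 :* w)) refl p w

Cf-even : ∀ f n → (2 + n) % 2 ≡ 0 → Cf (suc f) (2 + n) ≡ 1 ∸ Cf f ((2 + n) / 2)
Cf-even f n [2+n]%2≡0 with (2 + n) % 2
... | zero = refl

Cf-odd : ∀ f n → (2 + n) % 2 ≡ 1 → Cf (suc f) (2 + n) ≡ 1 ∸ Cf f n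
Cf-odd f n [2+n]%2≡1 with (2 + n) % 2
... | suc _ = refl

[2+n]/2≤1+n : ∀ n → (2 + n) / 2 ≤ 1 + n
[2+n]/2≤1+n n = ≤-pred (m/n<m (2 + n) 2 ≤-refl)

Cf-fuel-irrelevant : ∀ {f g} n → n ≤ f → n ≤ g → Cf f n ≡ Cf g n
Cf-fuel-irrelevant {zero}  {zero}  zero _ _ = refl
Cf-fuel-irrelevant {zero}  {suc _} zero _ _ = refl
Cf-fuel-irrelevant {suc _} {zero}  zero _ _ = refl
Cf-fuel-irrelevant {suc _} {suc _} zero _ _ = refl
Cf-fuel-irrelevant {suc _} {suc _} (suc zero) _ _ = refl
Cf-fuel-irrelevant {suc f} {suc g} (suc (suc n)) (s≤s n<f) (s≤s n<g) with (2 + n) % 2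
... | zero  = cong (1 ∸_) (Cf-fuel-irrelevant _ (≤-trans ([2+n]/2≤1+n n) n<f) (≤-trans ([2+n]/2≤1+n n) n<g))
... | suc _ = cong (1 ∸_) (Cf-fuel-irrelevant n (<⇒≤ n<f) (<⇒≤ n<g))

C[k*2]≡1∸C[k] : ∀ {k} → 1 ≤ k → C (k * 2) ≡ 1 ∸ C k
C[k*2]≡1∸C[k] {suc j} _ = begin
  Cf (2 + j * 2) (2 + j * 2)               ≡⟨ Cf-even (1 + j * 2) (j * 2) (m*n%n≡0 (suc j) 2) ⟩
  1 ∸ Cf (1 + j * 2) ((2 + j * 2) / 2)     ≡⟨ cong (λ n → 1 ∸ Cf (1 + j * 2) n) (m*n/n≡m (suc j) 2) ⟩
  1 ∸ Cf (1 + j * 2) (suc j)               ≡⟨ cong (1 ∸_) (Cf-fuel-irrelevant (suc j) (s≤s (m≤m*n j 2)) ≤-refl) ⟩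
  1 ∸ C (suc j)                            ∎

C[3+m*2]≡1∸C[1+m*2] : ∀ m → C (3 + m * 2) ≡ 1 ∸ C (1 + m * 2)
C[3+m*2]≡1∸C[1+m*2] m = begin
  Cf (3 + m * 2) (3 + m * 2)   ≡⟨ Cf-odd (2 + m * 2) (1 + m * 2) ([m+kn]%n≡m%n 3 m 2) ⟩
  1 ∸ Cf (2 + m * 2) (1 + m * 2) ≡⟨ cong (1 ∸_) (Cf-fuel-irrelevant (1 + m * 2) (n≤1+n _) ≤-refl) ⟩
  1 ∸ C (1 + m * 2)            ∎

infix 4 _%4≡_

_%4≡_ : ℕ → ℕ → Set
v %4≡ r = ∃[ s ] v ≡ r + s * 4

3*-%4≡1 : ∀ {v} → v %4≡ 1 → 3 * v %4≡ 3
3*-%4≡1 (s , v≡1+4s) = 3 * s , trans (cong (3 *_) v≡1+4s)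
  (solve 1 (λ s → con 3 :* (con 1 :+ s :* con 4) := con 3 :+ con 3 :* s :* con 4) refl s)

3*-%4≡3 : ∀ {v} → v %4≡ 3 → 3 * v %4≡ 1
3*-%4≡3 (s , v≡3+4s) = 2 + 3 * s , trans (cong (3 *_) v≡3+4s)
  (solve 1 (λ s → con 3 :* (con 3 :+ s :* con 4) := con 1 :+ (con 2 :+ con 3 :* s) :* con 4) refl s)

CTracksResidue : ℕ → ℕ → Set
CTracksResidue n v = (C n ≡ 0 × v %4≡ 1) ⊎ (C n ≡ 1 × v %4≡ 3)

CTracksResidue-odd : ∀ m → CTracksResidue (1 + m * 2) (1 + m * 2)
CTracksResidue-odd zero = inj₁ (refl , 0 , refl)
CTracksResidue-odd (suc m) with CTracksResidue-odd m
... | inj₁ (c≡0 , s , e) = inj₂ (trans (C[3+m*2]≡1∸C[1+m*2] m) (cong (1 ∸_) c≡0) , s , cong (2 +_) e)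
... | inj₂ (c≡1 , s , e) = inj₁ (trans (C[3+m*2]≡1∸C[1+m*2] m) (cong (1 ∸_) c≡1) , suc s , cong (2 +_) e)

CTracksResidue-double : ∀ {n v} → 1 ≤ n → CTracksResidue n v → CTracksResidue (n * 2) (3 * v)
CTracksResidue-double 1≤n (inj₁ (c≡0 , v%4≡1)) = inj₂ (trans (C[k*2]≡1∸C[k] 1≤n) (cong (1 ∸_) c≡0) , 3*-%4≡1 v%4≡1)
CTracksResidue-double 1≤n (inj₂ (c≡1 , v%4≡3)) = inj₁ (trans (C[k*2]≡1∸C[k] 1≤n) (cong (1 ∸_) c≡1) , 3*-%4≡3 v%4≡3)

CTracksResidue-2^a : ∀ a m → CTracksResidue (2 ^ a * (1 + m * 2)) (3 ^ a * (1 + m * 2))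
CTracksResidue-2^a zero    m =
  subst₂ CTracksResidue (sym (*-identityˡ (1 + m * 2))) (sym (*-identityˡ (1 + m * 2))) (CTracksResidue-odd m)
CTracksResidue-2^a (suc a) m = subst₂ CTracksResidue
  (trans (*-comm (2 ^ a * w) 2) (sym (*-assoc 2 (2 ^ a) w)))
  (sym (*-assoc 3 (3 ^ a) w))
  (CTracksResidue-double (*-mono-≤ (m^n>0 2 a) (s≤s z≤n)) (CTracksResidue-2^a a m))
  where w = 1 + m * 2

C[2^a*w]≡1⇒3^a*w%4≡3 : ∀ a m → C (2 ^ a * (1 + m * 2)) ≡ 1 → 3 ^ a * (1 + m * 2) %4≡ 3
C[2^a*w]≡1⇒3^a*w%4≡3 a m c≡1 with CTracksResidue-2^a a m
... | inj₁ (c≡0 , _)      = contradiction (trans (sym c≡0) c≡1) λ ()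
... | inj₂ (_ , v%4≡3)    = v%4≡3

even-or-odd : ∀ n → (∃[ k ] n ≡ k * 2) ⊎ (∃[ k ] n ≡ 1 + k * 2)
even-or-odd zero = inj₁ (0 , refl)
even-or-odd (suc n) with even-or-odd n
... | inj₁ (k , refl) = inj₂ (k , refl)
... | inj₂ (k , refl) = inj₁ (suc k , refl)

2-adic-decomposition : ∀ i → 1 ≤ i → ∃₂ λ a m → i ≡ 2 ^ a * (1 + m * 2)
2-adic-decomposition = <-rec _ decompose
  where
  decompose : ∀ i → (∀ {j} → j < i → 1 ≤ j → ∃₂ λ a m → j ≡ 2 ^ a * (1 + m * 2)) →
              1 ≤ i → ∃₂ λ a m → i ≡ 2 ^ a * (1 + m * 2)
  decompose i rec 1≤i with even-or-odd i
  ... | inj₂ (m , refl)     = 0 , m , sym (*-identityˡ (1 + m * 2))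
  ... | inj₁ (zero , refl)  = contradiction 1≤i λ ()
  ... | inj₁ (suc k , refl) with rec (m<m*n (suc k) 2 ≤-refl) (s≤s z≤n)
  ...   | a , m , k+1≡2^a*w = suc a , m ,
    trans (cong (_* 2) k+1≡2^a*w) (trans (*-comm (2 ^ a * w) 2) (sym (m^[b+a]*w≡m^b*[m^a*w] 2 1 a w)))
    where w = 1 + m * 2

T[8p∸2]≡4p∸1 : ∀ p → T (8 * p ∸ 2) ≡ 4 * p ∸ 1
T[8p∸2]≡4p∸1 p = begin
  T (8 * p ∸ 2)         ≡⟨ cong (λ n → T (n ∸ 2)) (solve 1 (λ p → con 8 :* p := con 4 :* p :* con 2) refl p) ⟩
  T (4 * p * 2 ∸ 1 * 2) ≡⟨ cong T (*-distribʳ-∸ 2 (4 * p) 1) ⟨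
  T ((4 * p ∸ 1) * 2)   ≡⟨ T[k*2]≡k (4 * p ∸ 1) ⟩
  4 * p ∸ 1             ∎

T²[2+t*4]≡2+3t : ∀ t → T^ 2 (2 + t * 4) ≡ 2 + 3 * t
T²[2+t*4]≡2+3t t = begin
  T (T (2 + t * 4))         ≡⟨ cong (λ n → T (T n)) (solve 1 (λ t → con 2 :+ t :* con 4 := (con 1 :+ t :* con 2) :* con 2) refl t) ⟩
  T (T ((1 + t * 2) * 2))   ≡⟨ cong T (T[k*2]≡k (1 + t * 2)) ⟩
  T (1 + t * 2)             ≡⟨ T[1+k*2]≡2+3k t ⟩
  2 + 3 * t                 ∎

T²[k*4]≡k : ∀ k → T^ 2 (k * 4) ≡ k
T²[k*4]≡k k = begin
  T (T (k * 4))       ≡⟨ cong (λ n → T (T n)) (*-assoc k 2 2) ⟨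
  T (T (k * 2 * 2))   ≡⟨ cong T (T[k*2]≡k (k * 2)) ⟩
  T (k * 2)           ≡⟨ T[k*2]≡k k ⟩
  k                   ∎

SameStoppingTime-8i∸2-8i∸1 : ∀ a {w} → 1 ≤ w → 3 ^ a * w %4≡ 3 →
                             SameStoppingTime (8 * (2 ^ a * w) ∸ 2) (8 * (2 ^ a * w) ∸ 1)
-- Matching the pair lets t reduce to a term of the form 3 * (2 + …), so 3 ≤ 2 + 3 * t holds by evaluation.
SameStoppingTime-8i∸2-8i∸1 a {w} 1≤w 3^a*w%4≡3@(_ , _) =
  meet⇒SameStoppingTime (3 + a + 2) x-orbit y-orbit (s≤s (s≤s (s≤s z≤n)))
  where
  i = 2 ^ a * w
  9*3^a*w%4≡3 : 3 * (3 * (3 ^ a * w)) %4≡ 3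
  9*3^a*w%4≡3 = 3*-%4≡1 (3*-%4≡3 3^a*w%4≡3)
  t = proj₁ 9*3^a*w%4≡3
  u≡3+4t : 3 ^ (2 + a) * w ≡ 3 + t * 4
  u≡3+4t = trans (m^[b+a]*w≡m^b*[m^a*w] 3 2 a w) (trans (*-assoc 3 3 (3 ^ a * w)) (proj₂ 9*3^a*w%4≡3))

  x-orbit : T^ (3 + a + 2) (8 * i ∸ 2) ≡ 2 + 3 * t
  x-orbit = begin
    T^ (3 + a + 2) (8 * i ∸ 2)               ≡⟨ T^-+ (3 + a) 2 (8 * i ∸ 2) ⟩
    T^ 2 (T^ (2 + a) (T (8 * i ∸ 2)))        ≡⟨ cong (λ n → T^ 2 (T^ (2 + a) n)) (T[8p∸2]≡4p∸1 i) ⟩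
    T^ 2 (T^ (2 + a) (4 * i ∸ 1))            ≡⟨ cong (λ n → T^ 2 (T^ (2 + a) (n ∸ 1))) (m^[b+a]*w≡m^b*[m^a*w] 2 2 a w) ⟨
    T^ 2 (T^ (2 + a) (2 ^ (2 + a) * w ∸ 1))  ≡⟨ cong (T^ 2) (T^[2^b*w∸1]≡3^b*w∸1 (2 + a) 1≤w) ⟩
    T^ 2 (3 ^ (2 + a) * w ∸ 1)               ≡⟨ cong (λ n → T^ 2 (n ∸ 1)) u≡3+4t ⟩
    T^ 2 (2 + t * 4)                         ≡⟨ T²[2+t*4]≡2+3t t ⟩
    2 + 3 * t                                ∎

  y-orbit : T^ (3 + a + 2) (8 * i ∸ 1) ≡ 2 + 3 * t
  y-orbit = begin
    T^ (3 + a + 2) (8 * i ∸ 1)               ≡⟨ T^-+ (3 + a) 2 (8 * i ∸ 1) ⟩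
    T^ 2 (T^ (3 + a) (8 * i ∸ 1))            ≡⟨ cong (λ n → T^ 2 (T^ (3 + a) (n ∸ 1))) (m^[b+a]*w≡m^b*[m^a*w] 2 3 a w) ⟨
    T^ 2 (T^ (3 + a) (2 ^ (3 + a) * w ∸ 1))  ≡⟨ cong (T^ 2) (T^[2^b*w∸1]≡3^b*w∸1 (3 + a) 1≤w) ⟩
    T^ 2 (3 ^ (3 + a) * w ∸ 1)               ≡⟨ cong (λ n → T^ 2 (n ∸ 1)) (trans (*-assoc 3 (3 ^ (2 + a)) w) (cong (3 *_) u≡3+4t)) ⟩
    T^ 2 (3 * (3 + t * 4) ∸ 1)               ≡⟨ cong (λ n → T^ 2 (n ∸ 1)) (solve 1 (λ t → con 3 :* (con 3 :+ t :* con 4)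
                                                                                       := con 1 :+ (con 2 :+ con 3 :* t) :* con 4) refl t) ⟩
    T^ 2 ((2 + 3 * t) * 4)                   ≡⟨ T²[k*4]≡k (2 + 3 * t) ⟩
    2 + 3 * t                                ∎

corollary5p4 : ∀ (i : ℕ) → 1 ≤ i → C i ≡ 1 →
    SameStoppingTime (8 * i ∸ 2) (8 * i ∸ 1)
corollary5p4 i 1≤i C[i]≡1 with 2-adic-decomposition i 1≤i
... | a , m , refl = SameStoppingTime-8i∸2-8i∸1 a (s≤s z≤n) (C[2^a*w]≡1⇒3^a*w%4≡3 a m C[i]≡1)
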